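{- Let $A$ be a finite set of positive integers. If $A$ contains no two consecutive integers, put $\bar A=A$; otherwise let $j$ be the largest element of $A$ with $j+1\in A$ and put $\bar A=\{k\in A:k\ge j\}$. Then $$z\Big(\sum_{k\in A}2^{k-1}\Big)=\sum_{k\in\bar A}F_k.$$
   Context: $(F_k)_{k\ge1}$ is the Fibonacci sequence with $F_1=1$, $F_2=2$, $F_{k+2}=F_{k+1}+F_k$. For a non-negative integer $x$, $z(x)$ is the number of integers $n$ with $0\le n<x$ whose binary expansion $n=\sum_{k\ge1}\epsilon_k2^{k-1}$ ($\epsilon_k\in\{0,1\}$) has no index $k$ with $\epsilon_k=\epsilon_{k+1}=1$. -}

module Defs where

open import Data.Nat using (ℕ; zero; suc; _+_; _/_; _%_; _≡ᵇ_; _^_; _∸_)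
open import Data.Bool using (Bool; true; false; not; _∧_; if_then_else_)
open import Data.List using (List; map; upTo)
open import Data.Nat.ListAction using (sum)

-- Fibonacci numbers with F 1 = 1, F 2 = 2, F (k+2) = F (k+1) + F k.
-- (F 0 = 1 is never used by the statement, which only evaluates F at k ≥ 1.)
F : ℕ → ℕ
F zero = 1
F (suc zero) = 1
F (suc (suc n)) = F (suc n) + F n

-- The fuel n suffices: m halves each step and the check is vacuous once m = 0.
noAdjOnesAux : ℕ → ℕ → Bool
noAdjOnesAux zero m = true
noAdjOnesAux (suc fuel) m =
  not ((m % 2 ≡ᵇ 1) ∧ ((m / 2) % 2 ≡ᵇ 1)) ∧ noAdjOnesAux fuel (m / 2)

noAdjOnes : ℕ → Bool
noAdjOnes n = noAdjOnesAux n n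

z : ℕ → ℕ
z x = sum (map (λ n → if noAdjOnes n then 1 else 0) (upTo x))

-- Σ_{k ∈ A} 2^(k-1), for a finite set A given as a duplicate-free list
binVal : List ℕ → ℕ
binVal A = sum (map (λ k → 2 ^ (k ∸ 1)) A)

fibSum : List ℕ → ℕ
fibSum A = sum (map F A)

module Submission where

-- For i < 2^n, the number 2^n + i has no two adjacent 1s iff i has none and
-- i < 2^(n-1), i.e. the digit just below the leading one is 0. Counting, this
-- gives z(2^n + y) = z(2^n) + z(min(y, 2^(n-1))) for y ≤ 2^n, hence
-- z(2^n) = F(n+1). Listing A in decreasing order, each element k+1 that is not
-- followed by k contributes z(2^k) = F(k+1) and passes the rest on unchanged,
-- while at the first pair k+1, k the rest saturates at 2^(k-1), whose count is
-- F k, and the smaller elements are lost.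

open import Data.Bool using (Bool; true; false; not; _∧_; if_then_else_; T)
open import Data.Bool.Properties using (∧-assoc; ∧-identityʳ; ∧-zeroʳ)
open import Data.List using (List; []; _∷_; [_]; _++_; map; filter; upTo)
open import Data.List.Membership.Propositional using (_∈_; _∉_)
open import Data.List.Properties using (upTo-∷ʳ; map-++; filter-accept; filter-none)
open import Data.List.Relation.Binary.Permutation.Propositional using (_↭_; ↭-sym; ↭⇒↭ₛ)
open import Data.List.Relation.Binary.Permutation.Propositional.Properties
  using (∈-resp-↭; All-resp-↭; map⁺; filter-↭)
open import Data.List.Relation.Unary.All as All using (All; []; _∷_)
open import Data.List.Relation.Unary.AllPairs as AllPairs using (AllPairs; []; _∷_)
open import Data.List.Relation.Unary.Any using (here; there)
open import Data.List.Relation.Unary.Sorted.TotalOrder.Properties using (Sorted⇒AllPairs)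
open import Data.List.Relation.Unary.Unique.Propositional using (Unique)
open import Data.Nat
open import Data.Nat.DivMod
open import Data.Nat.Divisibility using (m∣m*n)
open import Data.Nat.ListAction using (sum)
open import Data.Nat.ListAction.Properties using (sum-++; sum-↭)
open import Data.Nat.Properties
open import Data.Product using (_×_; _,_)
open import Data.Sum using (inj₁; inj₂)
open import Defs
open import Function using (_∘_)
open import Relation.Binary.PropositionalEquality hiding ([_])
open import Relation.Nullary using (contradiction; yes; no)
open import Relation.Nullary.Decidable using (dec-true; dec-false)
open import Relation.Nullary.Reflects using (det; fromEquivalence)
import Relation.Binary.Construct.Flip.EqAndOrd as Flip
open import Data.List.Relation.Binary.Permutation.Setoid.Properties (setoid ℕ)
  using (Unique-resp-↭)
open import Data.List.Sort (Flip.decTotalOrder ≤-decTotalOrder) using (sort; sort-↭; sort-↗)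

lowestTwoBitsSet : ℕ → Bool
lowestTwoBitsSet m = (m % 2 ≡ᵇ 1) ∧ ((m / 2) % 2 ≡ᵇ 1)

noAdjOnesAux-0 : ∀ f → noAdjOnesAux f 0 ≡ true
noAdjOnesAux-0 zero    = refl
noAdjOnesAux-0 (suc f) = noAdjOnesAux-0 f

m≤1+n⇒m/2≤n : ∀ {m n} → m ≤ suc n → m / 2 ≤ n
m≤1+n⇒m/2≤n {zero}  _ = z≤n
m≤1+n⇒m/2≤n {suc m} m≤1+n = ≤-pred (≤-trans (m/n<m (suc m) 2 (s≤s (s≤s z≤n))) m≤1+n)

noAdjOnesAux-fuel : ∀ {m} f g → m ≤ f → m ≤ g → noAdjOnesAux f m ≡ noAdjOnesAux g m
noAdjOnesAux-fuel zero    g       z≤n _   = sym (noAdjOnesAux-0 g)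
noAdjOnesAux-fuel (suc f) zero    _   z≤n = noAdjOnesAux-0 (suc f)
noAdjOnesAux-fuel {m} (suc f) (suc g) m≤f m≤g =
  cong (not (lowestTwoBitsSet m) ∧_)
       (noAdjOnesAux-fuel f g (m≤1+n⇒m/2≤n m≤f) (m≤1+n⇒m/2≤n m≤g))

noAdjOnes-unfold : ∀ n → noAdjOnes n ≡ not (lowestTwoBitsSet n) ∧ noAdjOnes (n / 2)
noAdjOnes-unfold zero    = refl
noAdjOnes-unfold (suc n) =
  cong (not (lowestTwoBitsSet (suc n)) ∧_)
       (noAdjOnesAux-fuel n (suc n / 2) (m≤1+n⇒m/2≤n ≤-refl) ≤-refl)

[2^[1+n]+i]/2≡2^n+i/2 : ∀ n i → (2 ^ suc n + i) / 2 ≡ 2 ^ n + i / 2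
[2^[1+n]+i]/2≡2^n+i/2 n i = begin
  (2 * 2 ^ n + i) / 2      ≡⟨ +-distrib-/-∣ˡ i (m∣m*n (2 ^ n)) ⟩
  2 * 2 ^ n / 2 + i / 2    ≡⟨ cong (λ t → t / 2 + i / 2) (*-comm 2 (2 ^ n)) ⟩
  2 ^ n * 2 / 2 + i / 2    ≡⟨ cong (_+ i / 2) (m*n/n≡m (2 ^ n) 2) ⟩
  2 ^ n + i / 2            ∎
  where open ≡-Reasoning

lowestTwoBitsSet-2^[2+n]+ : ∀ n i → lowestTwoBitsSet (2 ^ suc (suc n) + i) ≡ lowestTwoBitsSet i
lowestTwoBitsSet-2^[2+n]+ n i =
  cong₂ (λ r q → (r ≡ᵇ 1) ∧ (q ≡ᵇ 1))
        (%-remove-+ˡ i (m∣m*n (2 ^ suc n)))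
        (trans (cong (_% 2) ([2^[1+n]+i]/2≡2^n+i/2 (suc n) i))
               (%-remove-+ˡ (i / 2) (m∣m*n (2 ^ n))))

m/2<ᵇn≡m<ᵇ2n : ∀ m n → (m / 2 <ᵇ n) ≡ (m <ᵇ 2 * n)
m/2<ᵇn≡m<ᵇ2n m n = det (<ᵇ-reflects-< (m / 2) n) (fromEquivalence m<2n⇒m/2<n m/2<n⇒m<2n)
  where
  m<2n⇒m/2<n : T (m <ᵇ 2 * n) → m / 2 < n
  m<2n⇒m/2<n t = m<n*o⇒m/o<n (subst (m <_) (*-comm 2 n) (<ᵇ⇒< m (2 * n) t))
  m/2<n⇒m<2n : m / 2 < n → T (m <ᵇ 2 * n)
  m/2<n⇒m<2n m/2<n = <⇒<ᵇ (≰⇒> λ 2n≤m →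
    <⇒≱ m/2<n (subst (_≤ m / 2) (m*n/n≡m n 2) (/-monoˡ-≤ 2 (subst (_≤ m) (*-comm 2 n) 2n≤m))))

noAdjOnes-2^n+ : ∀ n {i} → i < 2 ^ n → noAdjOnes (2 ^ n + i) ≡ noAdjOnes i ∧ (i <ᵇ 2 ^ (n ∸ 1))
noAdjOnes-2^n+ zero {zero} _ = refl
noAdjOnes-2^n+ zero {suc i} (s≤s ())
noAdjOnes-2^n+ (suc zero) {zero} _ = refl
noAdjOnes-2^n+ (suc zero) {suc zero} _ = refl
noAdjOnes-2^n+ (suc zero) {suc (suc i)} (s≤s (s≤s ()))
noAdjOnes-2^n+ (suc (suc n)) {i} i<2^[2+n] = begin
  noAdjOnes x                                         ≡⟨ noAdjOnes-unfold x ⟩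
  not (lowestTwoBitsSet x) ∧ noAdjOnes (x / 2)
    ≡⟨ cong₂ (λ b y → not b ∧ noAdjOnes y) (lowestTwoBitsSet-2^[2+n]+ n i)
                                            ([2^[1+n]+i]/2≡2^n+i/2 (suc n) i) ⟩
  not (lowestTwoBitsSet i) ∧ noAdjOnes (2 ^ suc n + i / 2)
    ≡⟨ cong (not (lowestTwoBitsSet i) ∧_) (noAdjOnes-2^n+ (suc n) i/2<2^[1+n]) ⟩
  not (lowestTwoBitsSet i) ∧ (noAdjOnes (i / 2) ∧ (i / 2 <ᵇ 2 ^ n))
    ≡⟨ ∧-assoc (not (lowestTwoBitsSet i)) (noAdjOnes (i / 2)) _ ⟨
  (not (lowestTwoBitsSet i) ∧ noAdjOnes (i / 2)) ∧ (i / 2 <ᵇ 2 ^ n)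
    ≡⟨ cong₂ _∧_ (sym (noAdjOnes-unfold i)) (m/2<ᵇn≡m<ᵇ2n i (2 ^ n)) ⟩
  noAdjOnes i ∧ (i <ᵇ 2 ^ suc n)                      ∎
  where
  open ≡-Reasoning
  x : ℕ
  x = 2 ^ suc (suc n) + i
  i/2<2^[1+n] : i / 2 < 2 ^ suc n
  i/2<2^[1+n] = m<n*o⇒m/o<n (subst (i <_) (*-comm 2 (2 ^ suc n)) i<2^[2+n])

-- z is definitionally count noAdjOnes.
count : (ℕ → Bool) → ℕ → ℕ
count p n = sum (map (λ i → if p i then 1 else 0) (upTo n))

count-suc : ∀ p n → count p (suc n) ≡ count p n + (if p n then 1 else 0)
count-suc p n = begin
  sum (map f (upTo (suc n)))       ≡⟨ cong (sum ∘ map f) (upTo-∷ʳ n) ⟨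
  sum (map f (upTo n ++ [ n ]))    ≡⟨ cong sum (map-++ f (upTo n) [ n ]) ⟩
  sum (map f (upTo n) ++ [ f n ])  ≡⟨ sum-++ (map f (upTo n)) [ f n ] ⟩
  count p n + (f n + 0)            ≡⟨ cong (count p n +_) (+-identityʳ (f n)) ⟩
  count p n + f n                  ∎
  where
  open ≡-Reasoning
  f : ℕ → ℕ
  f i = if p i then 1 else 0

count-cong : ∀ {p q} n → (∀ {i} → i < n → p i ≡ q i) → count p n ≡ count q n
count-cong zero _ = refl
count-cong {p} {q} (suc n) p≗q = begin
  count p (suc n)                    ≡⟨ count-suc p n ⟩
  count p n + (if p n then 1 else 0) ≡⟨ cong₂ (λ c b → c + (if b then 1 else 0))
                                               (count-cong n (p≗q ∘ m<n⇒m<1+n)) (p≗q ≤-refl) ⟩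
  count q n + (if q n then 1 else 0) ≡⟨ count-suc q n ⟨
  count q (suc n)                    ∎
  where open ≡-Reasoning

count-false : ∀ n → count (λ _ → false) n ≡ 0
count-false zero    = refl
count-false (suc n) = trans (count-suc (λ _ → false) n) (trans (+-identityʳ _) (count-false n))

count-+ : ∀ p m n → count p (m + n) ≡ count p m + count (λ i → p (m + i)) n
count-+ p m zero = trans (cong (count p) (+-identityʳ m)) (sym (+-identityʳ (count p m)))
count-+ p m (suc n) = begin
  count p (m + suc n)                              ≡⟨ cong (count p) (+-suc m n) ⟩
  count p (suc (m + n))                            ≡⟨ count-suc p (m + n) ⟩
  count p (m + n) + (if p (m + n) then 1 else 0)   ≡⟨ cong (_+ (if q n then 1 else 0)) (count-+ p m n) ⟩
  count p m + count q n + (if q n then 1 else 0)   ≡⟨ +-assoc (count p m) _ _ ⟩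
  count p m + (count q n + (if q n then 1 else 0)) ≡⟨ cong (count p m +_) (count-suc q n) ⟨
  count p m + count q (suc n)                      ∎
  where
  open ≡-Reasoning
  q : ℕ → Bool
  q i = p (m + i)

b∧[i<ᵇc]≡b : ∀ b {i c} → i < c → b ∧ (i <ᵇ c) ≡ b
b∧[i<ᵇc]≡b b {i} {c} i<c = trans (cong (b ∧_) (dec-true (i <? c) i<c)) (∧-identityʳ b)

b∧[i<ᵇc]≡false : ∀ b {i c} → c ≤ i → b ∧ (i <ᵇ c) ≡ false
b∧[i<ᵇc]≡false b {i} {c} c≤i = trans (cong (b ∧_) (dec-false (i <? c) (≤⇒≯ c≤i))) (∧-zeroʳ b)

count-∧-<ᵇ : ∀ p c n → count (λ i → p i ∧ (i <ᵇ c)) n ≡ count p (n ⊓ c)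
count-∧-<ᵇ p c n with ≤-total n c
... | inj₁ n≤c = begin
  count q n        ≡⟨ count-cong n (λ {i} i<n → b∧[i<ᵇc]≡b (p i) (<-≤-trans i<n n≤c)) ⟩
  count p n        ≡⟨ cong (count p) (m≤n⇒m⊓n≡m n≤c) ⟨
  count p (n ⊓ c)  ∎
  where
  open ≡-Reasoning
  q : ℕ → Bool
  q i = p i ∧ (i <ᵇ c)
... | inj₂ c≤n = begin
  count q n                                ≡⟨ cong (count q) (m+[n∸m]≡n c≤n) ⟨
  count q (c + (n ∸ c))                    ≡⟨ count-+ q c (n ∸ c) ⟩
  count q c + count (λ i → q (c + i)) (n ∸ c)
    ≡⟨ cong₂ _+_ (count-cong c (λ {i} → b∧[i<ᵇc]≡b (p i)))
                 (count-cong (n ∸ c) (λ {i} _ → b∧[i<ᵇc]≡false (p (c + i)) (m≤m+n c i))) ⟩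
  count p c + count (λ _ → false) (n ∸ c)  ≡⟨ cong (count p c +_) (count-false (n ∸ c)) ⟩
  count p c + 0                            ≡⟨ +-identityʳ (count p c) ⟩
  count p c                                ≡⟨ cong (count p) (m≥n⇒m⊓n≡n c≤n) ⟨
  count p (n ⊓ c)                          ∎
  where
  open ≡-Reasoning
  q : ℕ → Bool
  q i = p i ∧ (i <ᵇ c)

z-2^n+ : ∀ n {y} → y ≤ 2 ^ n → z (2 ^ n + y) ≡ z (2 ^ n) + z (y ⊓ 2 ^ (n ∸ 1))
z-2^n+ n {y} y≤2^n = begin
  count noAdjOnes (2 ^ n + y)                                ≡⟨ count-+ noAdjOnes (2 ^ n) y ⟩
  z (2 ^ n) + count (λ i → noAdjOnes (2 ^ n + i)) y
    ≡⟨ cong (z (2 ^ n) +_) (count-cong y (λ i<y → noAdjOnes-2^n+ n (<-≤-trans i<y y≤2^n))) ⟩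
  z (2 ^ n) + count (λ i → noAdjOnes i ∧ (i <ᵇ 2 ^ (n ∸ 1))) y
    ≡⟨ cong (z (2 ^ n) +_) (count-∧-<ᵇ noAdjOnes (2 ^ (n ∸ 1)) y) ⟩
  z (2 ^ n) + z (y ⊓ 2 ^ (n ∸ 1))                            ∎
  where open ≡-Reasoning

z-2^n : ∀ n → z (2 ^ n) ≡ F (suc n)
z-2^n zero          = refl
z-2^n (suc zero)    = refl
z-2^n (suc (suc n)) = begin
  z (2 ^ suc (suc n))                       ≡⟨ cong (λ t → z (2 ^ suc n + t)) (+-identityʳ (2 ^ suc n)) ⟩
  z (2 ^ suc n + 2 ^ suc n)                 ≡⟨ z-2^n+ (suc n) ≤-refl ⟩
  z (2 ^ suc n) + z (2 ^ suc n ⊓ 2 ^ n)     ≡⟨ cong (λ t → z (2 ^ suc n) + z t)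
                                                    (m≥n⇒m⊓n≡n (^-monoʳ-≤ 2 (n≤1+n n))) ⟩
  z (2 ^ suc n) + z (2 ^ n)                 ≡⟨ cong₂ _+_ (z-2^n (suc n)) (z-2^n n) ⟩
  F (suc (suc n)) + F (suc n)               ∎
  where open ≡-Reasoning

z-2^[n∸1] : ∀ n → z (2 ^ (n ∸ 1)) ≡ F n
z-2^[n∸1] zero    = refl
z-2^[n∸1] (suc n) = z-2^n n

binVal-< : ∀ {m L} → AllPairs _>_ L → All (1 ≤_) L → All (_< m) L → binVal L < 2 ^ (m ∸ 1)
binVal-< {m} [] [] [] = m^n>0 2 (m ∸ 1)
binVal-< {m} {suc k ∷ L} (L<1+k ∷ desc) (_ ∷ pos) (1+k<m ∷ _) = begin-strict
  2 ^ k + binVal L   <⟨ +-monoʳ-< (2 ^ k) (binVal-< desc pos L<1+k) ⟩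
  2 ^ k + 2 ^ k      ≡⟨ cong (2 ^ k +_) (+-identityʳ (2 ^ k)) ⟨
  2 ^ suc k          ≤⟨ ^-monoʳ-≤ 2 (∸-monoˡ-≤ 1 1+k<m) ⟩
  2 ^ (m ∸ 1)        ∎
  where open ≤-Reasoning

z-binVal-∷ : ∀ {m L} → AllPairs _>_ (suc m ∷ L) → All (1 ≤_) L →
             z (binVal (suc m ∷ L)) ≡ F (suc m) + z (binVal L ⊓ 2 ^ (m ∸ 1))
z-binVal-∷ {m} {L} (L<1+m ∷ desc) pos =
  trans (z-2^n+ m (<⇒≤ (binVal-< desc pos L<1+m))) (cong (_+ z (binVal L ⊓ 2 ^ (m ∸ 1))) (z-2^n m))

z-binVal-∷-gap : ∀ {m L} → AllPairs _>_ L → All (1 ≤_) L → All (_< m) L →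
                 z (binVal (suc m ∷ L)) ≡ F (suc m) + z (binVal L)
z-binVal-∷-gap {m} desc pos L<m =
  trans (z-binVal-∷ (All.map m<n⇒m<1+n L<m ∷ desc) pos)
        (cong (λ t → F (suc m) + z t) (m≤n⇒m⊓n≡m (<⇒≤ (binVal-< desc pos L<m))))

-- The pair k+1, k already fills the binary digit just below the leading one.
z-binVal-adjacent : ∀ {m L} → AllPairs _>_ (m ∷ L) → All (1 ≤_) (m ∷ L) →
                    z (binVal (suc m ∷ m ∷ L)) ≡ F (suc m) + F m
z-binVal-adjacent {m} {L} desc@(L<m ∷ _) pos = begin
  z (binVal (suc m ∷ m ∷ L))                    ≡⟨ z-binVal-∷ (m<1+m∷L ∷ desc) pos ⟩
  F (suc m) + z (binVal (m ∷ L) ⊓ 2 ^ (m ∸ 1))  ≡⟨ cong (λ t → F (suc m) + z t)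
                                                        (m≥n⇒m⊓n≡n (m≤m+n (2 ^ (m ∸ 1)) (binVal L))) ⟩
  F (suc m) + z (2 ^ (m ∸ 1))                   ≡⟨ cong (F (suc m) +_) (z-2^[n∸1] m) ⟩
  F (suc m) + F m                               ∎
  where
  open ≡-Reasoning
  m<1+m∷L : All (_< suc m) (m ∷ L)
  m<1+m∷L = n<1+n m ∷ All.map m<n⇒m<1+n L<m

∈-∷⁻ : ∀ {x y : ℕ} {L} → x ∈ y ∷ L → x ≢ y → x ∈ L
∈-∷⁻ (here x≡y) x≢y = contradiction x≡y x≢y
∈-∷⁻ (there x∈L) _  = x∈L

∈-∷⇒≤ : ∀ {x y L} → All (_< y) L → x ∈ y ∷ L → x ≤ y
∈-∷⇒≤ _    (here refl) = ≤-refl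
∈-∷⇒≤ L<y (there x∈L) = <⇒≤ (All.lookup L<y x∈L)

All-<-suc⇒All-< : ∀ {m L} → All (_< suc m) L → m ∉ L → All (_< m) L
All-<-suc⇒All-< []              _  = []
All-<-suc⇒All-< (x<1+m ∷ L<1+m) m∉ =
  ≤∧≢⇒< (≤-pred x<1+m) (m∉ ∘ here ∘ sym) ∷ All-<-suc⇒All-< L<1+m (m∉ ∘ there)

z-binVal-nonadjacent : ∀ {L} → AllPairs _>_ L → All (1 ≤_) L → (∀ k → k ∈ L → suc k ∉ L) →
                       z (binVal L) ≡ fibSum L
z-binVal-nonadjacent [] [] _ = refl
z-binVal-nonadjacent {suc m ∷ L} (L<1+m ∷ desc) (_ ∷ pos) nonadj = begin
  z (binVal (suc m ∷ L))    ≡⟨ z-binVal-∷-gap desc pos L<m ⟩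
  F (suc m) + z (binVal L)  ≡⟨ cong (F (suc m) +_) (z-binVal-nonadjacent desc pos
                                  (λ k k∈L 1+k∈L → nonadj k (there k∈L) (there 1+k∈L))) ⟩
  F (suc m) + fibSum L      ∎
  where
  open ≡-Reasoning
  L<m : All (_< m) L
  L<m = All-<-suc⇒All-< L<1+m (λ m∈L → nonadj m (there m∈L) (here refl))

filter-≤?-adjacent : ∀ {m L} → All (_< m) L → filter (m ≤?_) (suc m ∷ m ∷ L) ≡ suc m ∷ m ∷ []
filter-≤?-adjacent {m} L<m =
  trans (filter-accept (m ≤?_) (n≤1+n m))
        (cong (suc m ∷_) (trans (filter-accept (m ≤?_) ≤-refl)
                                (cong (m ∷_) (filter-none (m ≤?_) (All.map <⇒≱ L<m)))))

z-binVal-topAdjacent : ∀ {L j} → AllPairs _>_ L → All (1 ≤_) L → j ∈ L → suc j ∈ L →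
                       (∀ i → i ∈ L → suc i ∈ L → i ≤ j) →
                       z (binVal L) ≡ fibSum (filter (j ≤?_) L)
z-binVal-topAdjacent {suc m ∷ []} _ _ (here refl) (here ())
z-binVal-topAdjacent {suc m ∷ []} _ _ _ (there ())
z-binVal-topAdjacent {suc m ∷ []} _ _ (there ()) _
z-binVal-topAdjacent {suc m ∷ h ∷ L} {j} (h∷L<1+m ∷ desc′@(L<h ∷ _)) (_ ∷ pos) j∈ 1+j∈ maximal
  with h ≟ m
... | yes refl = begin
  z (binVal (suc m ∷ m ∷ L))               ≡⟨ z-binVal-adjacent desc′ pos ⟩
  F (suc m) + F m                          ≡⟨ cong (F (suc m) +_) (+-identityʳ (F m)) ⟨
  fibSum (suc m ∷ m ∷ [])                  ≡⟨ cong fibSum (filter-≤?-adjacent L<h) ⟨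
  fibSum (filter (m ≤?_) (suc m ∷ m ∷ L))  ≡⟨ cong (λ k → fibSum (filter (k ≤?_) (suc m ∷ m ∷ L))) j≡m ⟨
  fibSum (filter (j ≤?_) (suc m ∷ m ∷ L))  ∎
  where
  open ≡-Reasoning
  j≡m : j ≡ m
  j≡m = ≤-antisym (≤-pred (∈-∷⇒≤ h∷L<1+m 1+j∈)) (maximal m (there (here refl)) (here refl))
... | no h≢m = begin
  z (binVal (suc m ∷ h ∷ L))                   ≡⟨ z-binVal-∷-gap desc′ pos h∷L<m ⟩
  F (suc m) + z (binVal (h ∷ L))               ≡⟨ cong (F (suc m) +_) (z-binVal-topAdjacent desc′ pos
                                                     j∈h∷L 1+j∈h∷L (λ i i∈ 1+i∈ → maximal i (there i∈) (there 1+i∈))) ⟩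
  F (suc m) + fibSum (filter (j ≤?_) (h ∷ L))  ≡⟨ cong fibSum (filter-accept (j ≤?_) (<⇒≤ j<1+m)) ⟨
  fibSum (filter (j ≤?_) (suc m ∷ h ∷ L))      ∎
  where
  open ≡-Reasoning
  h<m : h < m
  h<m = ≤∧≢⇒< (≤-pred (All.head h∷L<1+m)) h≢m
  h∷L<m : All (_< m) (h ∷ L)
  h∷L<m = h<m ∷ All.map (λ x<h → <-trans x<h h<m) L<h
  j≢m : j ≢ m
  j≢m refl = <-irrefl refl (All.lookup h∷L<m (∈-∷⁻ j∈ (1+n≢n ∘ sym)))
  1+j∈h∷L : suc j ∈ h ∷ L
  1+j∈h∷L = ∈-∷⁻ 1+j∈ (j≢m ∘ suc-injective)
  j<1+m : j < suc m
  j<1+m = <-trans (n<1+n j) (m<n⇒m<1+n (All.lookup h∷L<m 1+j∈h∷L))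
  j∈h∷L : j ∈ h ∷ L
  j∈h∷L = ∈-∷⁻ j∈ (<⇒≢ j<1+m)

binVal-↭ : ∀ {A B} → A ↭ B → binVal A ≡ binVal B
binVal-↭ A↭B = sum-↭ (map⁺ (λ k → 2 ^ (k ∸ 1)) A↭B)

fibSum-↭ : ∀ {A B} → A ↭ B → fibSum A ≡ fibSum B
fibSum-↭ A↭B = sum-↭ (map⁺ F A↭B)

sort-strictlyDecreasing : ∀ {A} → Unique A → AllPairs _>_ (sort A)
sort-strictlyDecreasing {A} unique = AllPairs.zipWith (λ (y≤x , x≢y) → ≤∧≢⇒< y≤x (x≢y ∘ sym))
  ( Sorted⇒AllPairs (Flip.totalOrder ≤-totalOrder) (sort-↗ A)
  , Unique-resp-↭ (↭⇒↭ₛ (↭-sym (sort-↭ A))) unique )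

lemma1p5 : (A : List ℕ) → Unique A → All (λ k → 1 ≤ k) A →
    ((∀ k → k ∈ A → suc k ∉ A) → z (binVal A) ≡ fibSum A)
    × (∀ j → j ∈ A → suc j ∈ A → (∀ i → i ∈ A → suc i ∈ A → i ≤ j) →
       z (binVal A) ≡ fibSum (filter (j ≤?_) A))
lemma1p5 A unique positive = nonadjacent , topAdjacent
  where
  open ≡-Reasoning
  D↭A : sort A ↭ A
  D↭A = sort-↭ A
  desc : AllPairs _>_ (sort A)
  desc = sort-strictlyDecreasing unique
  posD : All (1 ≤_) (sort A)
  posD = All-resp-↭ (↭-sym D↭A) positive
  toA : ∀ {x} → x ∈ sort A → x ∈ A
  toA = ∈-resp-↭ D↭A
  toD : ∀ {x} → x ∈ A → x ∈ sort A
  toD = ∈-resp-↭ (↭-sym D↭A)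
  nonadjacent : (∀ k → k ∈ A → suc k ∉ A) → z (binVal A) ≡ fibSum A
  nonadjacent nonadj = begin
    z (binVal A)         ≡⟨ cong z (binVal-↭ D↭A) ⟨
    z (binVal (sort A))  ≡⟨ z-binVal-nonadjacent desc posD (λ k k∈ 1+k∈ → nonadj k (toA k∈) (toA 1+k∈)) ⟩
    fibSum (sort A)      ≡⟨ fibSum-↭ D↭A ⟩
    fibSum A             ∎
  topAdjacent : ∀ j → j ∈ A → suc j ∈ A → (∀ i → i ∈ A → suc i ∈ A → i ≤ j) →
                z (binVal A) ≡ fibSum (filter (j ≤?_) A)
  topAdjacent j j∈ 1+j∈ maximal = begin
    z (binVal A)                        ≡⟨ cong z (binVal-↭ D↭A) ⟨
    z (binVal (sort A))                 ≡⟨ z-binVal-topAdjacent desc posD (toD j∈) (toD 1+j∈)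
                                             (λ i i∈ 1+i∈ → maximal i (toA i∈) (toA 1+i∈)) ⟩
    fibSum (filter (j ≤?_) (sort A))    ≡⟨ fibSum-↭ (filter-↭ (j ≤?_) D↭A) ⟩
    fibSum (filter (j ≤?_) A)           ∎
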